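{- Let $P$ and $Q$ be MIAs with common input alphabet $I$, common output alphabet $O$ and disjoint state sets, and let $F$ be the set of inconsistent states of the conjunctive product $P\& Q$. Then (i) for every MIA-witness $W$ of $P\& Q$, $F\cap W=\emptyset$; and (ii) the set $\{(p,q)\in P\times Q: \text{there are a MIA } R \text{ and } r\in R \text{ with } r\sqsubseteq_{\mathrm{MIA}} p \text{ and } r\sqsubseteq_{\mathrm{MIA}} q\}\cup P\cup Q$ is a MIA-witness of $P\& Q$.
   Context: A dMTS is $(P,A,\longrightarrow_P,\dashrightarrow_P)$ with states $P$, alphabet $A$ not containing $\tau$, must-relation $\longrightarrow_P\subseteq P\times A\times(2^P\setminus\{\emptyset\})$, may-relation $\dashrightarrow_P\subseteq P\times(A\cup\{\tau\})\times P$, and syntactic consistency ($p\xrightarrow{a}P'$ implies $p\stackrel{a}{\dashrightarrow}p'$ for all $p'\in P'$). A Modal Interface Automaton (MIA) is $(P,I,O,\longrightarrow_P,\dashrightarrow_P)$ with $I,O$ disjoint such that $(P,I\cup O,\longrightarrow_P,\dashrightarrow_P)$ is a dMTS and for all $i\in I$: (a) $p\xrightarrow{i}P'$ and $p\xrightarrow{i}P''$ imply $P'=P''$; (b) $p\stackrel{i}{\dashrightarrow}p'$ implies $p\xrightarrow{i}P'$ for some $P'\ni p'$. Write $p\xrightarrow{a}$ ($p\stackrel{a}{\dashrightarrow}$) if some must- (may-) $a$-transition leaves $p$. Weak may: $p\stackrel{\epsilon}{\Longrightarrow}p'$ iff $p(\stackrel{\tau}{\dashrightarrow})^*p'$; $p\stackrel{\alpha}{\Longrightarrow}p'$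 iff $\exists p''.\,p\stackrel{\epsilon}{\Longrightarrow}p''\stackrel{\alpha}{\dashrightarrow}p'$; $p\stackrel{\alpha}{\Longrightarrow}$ if such $p'$ exists; $\hat\tau=\epsilon$, $\hat a=a$. For MIAs $P,Q$ with the same $I,O$, $\mathcal R\subseteq P\times Q$ is a MIA-refinement relation if for all $(p,q)\in\mathcal R$: (i) $q\xrightarrow{a}Q'$ ($a\in I\cup O$) implies some $P'$ with $p\xrightarrow{a}P'$ and $\forall p'\in P'\,\exists q'\in Q'.\,(p',q')\in\mathcal R$; (ii) $p\stackrel{\alpha}{\dashrightarrow}p'$ with $\alpha\in O\cup\{\tau\}$ implies some $q'$ with $q\stackrel{\hat\alpha}{\Longrightarrow}q'$ and $(p',q')\in\mathcal R$. $p\sqsubseteq_{\mathrm{MIA}}q$ iff some such relation contains $(p,q)$. Conjunctive product $P\& Q$ (common $I,O$, disjoint state sets): state set $(P\times Q)\cup P\cup Q$, inheriting the transitions of $P$ and $Q$, plus, for $i\in I$, $o\in O$, $\alpha\in O\cup\{\tau\}$: (OMust1) $(p,q)\xrightarrow{o}\{(p',q'):p'\in P',q\stackrel{o}{\Longrightarrow}_Qq'\}$ if $p\xrightarrow{o}_PP'$ and $q\stackrel{o}{\Longrightarrow}_Q$; (OMust2) $(p,q)\xrightarrow{o}\{(p',q'):p\stackrel{o}{\Longrightarrow}_Pp',q'\in Q'\}$ if $p\stackrel{o}{\Longrightarrow}_P$ and $q\xrightarrow{o}_QQ'$; (IMust1) $(p,q)\xrightarrow{i}P'$ if $p\xrightarrow{i}_PP'$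 and no $i$-must from $q$; (IMust2) $(p,q)\xrightarrow{i}Q'$ if no $i$-must from $p$ and $q\xrightarrow{i}_QQ'$; (IMust3) $(p,q)\xrightarrow{i}P'\times Q'$ if $p\xrightarrow{i}_PP'$ and $q\xrightarrow{i}_QQ'$; (May1) $(p,q)\stackrel{\tau}{\dashrightarrow}(p',q)$ if $p\stackrel{\tau}{\Longrightarrow}_Pp'$; (May2) $(p,q)\stackrel{\tau}{\dashrightarrow}(p,q')$ if $q\stackrel{\tau}{\Longrightarrow}_Qq'$; (May3) $(p,q)\stackrel{\alpha}{\dashrightarrow}(p',q')$ if $p\stackrel{\alpha}{\Longrightarrow}_Pp'$ and $q\stackrel{\alpha}{\Longrightarrow}_Qq'$; (IMay1) $(p,q)\stackrel{i}{\dashrightarrow}p'$ if $p\stackrel{i}{\dashrightarrow}_Pp'$ and no $i$-may from $q$; (IMay2) $(p,q)\stackrel{i}{\dashrightarrow}q'$ if no $i$-may from $p$ and $q\stackrel{i}{\dashrightarrow}_Qq'$; (IMay3) $(p,q)\stackrel{i}{\dashrightarrow}(p',q')$ if $p\stackrel{i}{\dashrightarrow}_Pp'$ and $q\stackrel{i}{\dashrightarrow}_Qq'$. The set $F\subseteq P\times Q$ of inconsistent states is the least set with: (F1) $p\xrightarrow{o}_P$, not $q\stackrel{o}{\Longrightarrow}_Q$, $o\in O$ imply $(p,q)\in F$; (F2) not $p\stackrel{o}{\Longrightarrow}_P$, $q\xrightarrow{o}_Q$, $o\in O$ imply $(p,q)\in F$; (F3) $(p,q)\xrightarrow{a}R'$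 in $P\& Q$ with $R'\subseteq F$ implies $(p,q)\in F$. A MIA-witness of $P\& Q$ is a set $W\subseteq(P\times Q)\cup P\cup Q$ such that for all pairs $(p,q)\in W$: (W1) $p\xrightarrow{o}_P$ with $o\in O$ implies $q\stackrel{o}{\Longrightarrow}_Q$; (W2) $q\xrightarrow{o}_Q$ with $o\in O$ implies $p\stackrel{o}{\Longrightarrow}_P$; (W3) $(p,q)\xrightarrow{a}R'$ in $P\& Q$ implies $R'\cap W\neq\emptyset$. -}

module Defs where

open import Level using (Level; _⊔_; Lift) renaming (zero to 0ℓ; suc to lsuc)
open import Data.Product using (Σ; ∃; ∃-syntax; _×_; _,_)
open import Data.Sum using (_⊎_; inj₁; inj₂)
open import Data.Empty using (⊥)
open import Data.Unit using (⊤)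
open import Relation.Nullary using (¬_)
open import Relation.Unary using (Pred; _≐_)
open import Relation.Binary.Construct.Closure.ReflexiveTransitive using (Star)

-- Actions: visible actions from an alphabet A, plus the internal action τ
-- (τ is a separate constructor, so τ ∉ A automatically).

data Act (A : Set) : Set where
  τ   : Act A
  vis : A → Act A

-- Modal Interface Automata over input alphabet I and output alphabet O.
-- The alphabet is I ⊎ O (so I and O are disjoint).
-- Sets of states are predicates  Pred State 0ℓ.

record MIA (I O : Set) : Set₁ where
  field
    State : Set
    must  : State → I ⊎ O → Pred State 0ℓ → Set
    may   : State → Act (I ⊎ O) → State → Set
    must-nonempty : ∀ {p a P'} → must p a P' → ∃[ p' ] P' p'
    must⇒may : ∀ {p a P' p'} → must p a P' → P' p' → may p (vis a) p'
    inp-det : ∀ {p i P' P''} → must p (inj₁ i) P' → must p (inj₁ i) P'' → P' ≐ P''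
    inp-may⇒must : ∀ {p i p'} → may p (vis (inj₁ i)) p' →
                   ∃[ P' ] (must p (inj₁ i) P' × P' p')

module _ {I O : Set} (M : MIA I O) where
  open MIA M

  HasMust : State → I ⊎ O → Set₁
  HasMust p a = ∃[ P' ] must p a P'

  HasMay : State → Act (I ⊎ O) → Set
  HasMay p α = ∃[ p' ] may p α p'

  WeakEps : State → State → Set
  WeakEps = Star (λ x y → may x τ y)

  Weak : State → Act (I ⊎ O) → State → Set
  Weak p α p' = ∃[ p'' ] (WeakEps p p'' × may p'' α p')

  HasWeak : State → Act (I ⊎ O) → Set
  HasWeak p α = ∃[ p' ] Weak p α p'

  WeakHat : State → Act (I ⊎ O) → State → Set
  WeakHat p τ       p' = WeakEps p p'
  WeakHat p (vis a) p' = Weak p (vis a) p'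

OutOrτ : {I O : Set} → Act (I ⊎ O) → Set
OutOrτ τ              = ⊤
OutOrτ (vis (inj₁ _)) = ⊥
OutOrτ (vis (inj₂ _)) = ⊤

module _ {I O : Set} (P Q : MIA I O) where
  private
    module P = MIA P
    module Q = MIA Q

  IsMIARefinement : (P.State → Q.State → Set) → Set₁
  IsMIARefinement ℛ = ∀ p q → ℛ p q →
    (∀ a Q' → Q.must q a Q' →
       ∃[ P' ] (P.must p a P' × (∀ p' → P' p' → ∃[ q' ] (Q' q' × ℛ p' q'))))
    × (∀ α p' → OutOrτ α → P.may p α p' →
       ∃[ q' ] (WeakHat Q q α q' × ℛ p' q'))

  _⊑MIA_ : P.State → Q.State → Set₁
  p ⊑MIA q = ∃[ ℛ ] (IsMIARefinement ℛ × ℛ p q)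

module Conj {I O : Set} (P Q : MIA I O) where
  private
    module P = MIA P
    module Q = MIA Q

  -- states (P × Q) ∪ P ∪ Q  (disjoint union: the state sets are disjoint)
  St : Set
  St = (P.State × Q.State) ⊎ (P.State ⊎ Q.State)

  pair : P.State → Q.State → St
  pair p q = inj₁ (p , q)

  embP : Pred P.State 0ℓ → Pred St 0ℓ
  embP P' (inj₂ (inj₁ p)) = P' p
  embP P' _               = ⊥

  embQ : Pred Q.State 0ℓ → Pred St 0ℓ
  embQ Q' (inj₂ (inj₂ q)) = Q' q
  embQ Q' _               = ⊥

  om1 : Pred P.State 0ℓ → Q.State → O → Pred St 0ℓ
  om1 P' q o (inj₁ (p' , q')) = P' p' × Weak Q q (vis (inj₂ o)) q'
  om1 P' q o _                = ⊥

  om2 : P.State → Pred Q.State 0ℓ → O → Pred St 0ℓ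
  om2 p Q' o (inj₁ (p' , q')) = Weak P p (vis (inj₂ o)) p' × Q' q'
  om2 p Q' o _                = ⊥

  prodT : Pred P.State 0ℓ → Pred Q.State 0ℓ → Pred St 0ℓ
  prodT P' Q' (inj₁ (p' , q')) = P' p' × Q' q'
  prodT P' Q' _                = ⊥

  data Must : St → I ⊎ O → Pred St 0ℓ → Set₁ where
    inhP   : ∀ {p a P'} → P.must p a P' → Must (inj₂ (inj₁ p)) a (embP P')
    inhQ   : ∀ {q a Q'} → Q.must q a Q' → Must (inj₂ (inj₂ q)) a (embQ Q')
    OMust1 : ∀ {p q o P'} → P.must p (inj₂ o) P' → HasWeak Q q (vis (inj₂ o)) →
             Must (pair p q) (inj₂ o) (om1 P' q o)
    OMust2 : ∀ {p q o Q'} → HasWeak P p (vis (inj₂ o)) → Q.must q (inj₂ o) Q' →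
             Must (pair p q) (inj₂ o) (om2 p Q' o)
    IMust1 : ∀ {p q i P'} → P.must p (inj₁ i) P' → ¬ HasMust Q q (inj₁ i) →
             Must (pair p q) (inj₁ i) (embP P')
    IMust2 : ∀ {p q i Q'} → ¬ HasMust P p (inj₁ i) → Q.must q (inj₁ i) Q' →
             Must (pair p q) (inj₁ i) (embQ Q')
    IMust3 : ∀ {p q i P' Q'} → P.must p (inj₁ i) P' → Q.must q (inj₁ i) Q' →
             Must (pair p q) (inj₁ i) (prodT P' Q')

  data F : St → Set₁ where
    F1 : ∀ {p q o} → HasMust P p (inj₂ o) → ¬ HasWeak Q q (vis (inj₂ o)) →
         F (pair p q)
    F2 : ∀ {p q o} → ¬ HasWeak P p (vis (inj₂ o)) → HasMust Q q (inj₂ o) →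
         F (pair p q)
    F3 : ∀ {p q a R'} → Must (pair p q) a R' → (∀ s → R' s → F s) →
         F (pair p q)

  IsWitness : ∀ {ℓ} → Pred St ℓ → Set (lsuc 0ℓ ⊔ ℓ)
  IsWitness W = ∀ p q → W (pair p q) →
      (∀ o → HasMust P p (inj₂ o) → HasWeak Q q (vis (inj₂ o)))
    × (∀ o → HasMust Q q (inj₂ o) → HasWeak P p (vis (inj₂ o)))
    × (∀ a R' → Must (pair p q) a R' → ∃[ s ] (R' s × W s))

  CommonRef : Pred St (lsuc 0ℓ)
  CommonRef (inj₁ (p , q)) =
    ∃[ R ] ∃[ r ] (_⊑MIA_ R P r p × _⊑MIA_ R Q r q)
  CommonRef (inj₂ _) = Lift (lsuc 0ℓ) ⊤

-- Part (i) is induction on the derivation of inconsistency: a witness state can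
-- never be F1/F2-inconsistent, and F3 always has a successor inside the witness.
-- For (ii), if r refines both p and q, every must-transition of p or q forces a
-- must-transition of r; any successor r' of it refines a successor on each side
-- (on the other side via r's output may-transition), so the pair is again
-- commonly refined.
module Submission where

open import Defs
open import Level using (Level; lift)
open import Data.Product using (_×_; _,_; proj₁; proj₂; ∃-syntax)
open import Data.Sum using (inj₁; inj₂)
open import Data.Empty using (⊥)
open import Data.Unit using (tt)
open import Relation.Unary using (Pred)

module _ {I O : Set} (R X : MIA I O) where
  private
    module R = MIA R
    module X = MIA X

  ⊑-must : ∀ {r x a X'} → _⊑MIA_ R X r x → X.must x a X' →
           ∃[ R' ] (R.must r a R' × (∀ {r'} → R' r' → ∃[ x' ] (X' x' × _⊑MIA_ R X r' x')))
  ⊑-must (ℛ , isRef , rℛx) m with proj₁ (isRef _ _ rℛx) _ _ m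
  ... | R' , m' , cover = R' , m' , λ {r'} r'∈ →
    let x' , x'∈ , r'ℛx' = cover r' r'∈ in x' , x'∈ , ℛ , isRef , r'ℛx'

  ⊑-output : ∀ {r x o r'} → _⊑MIA_ R X r x → R.may r (vis (inj₂ o)) r' →
             ∃[ x' ] (Weak X x (vis (inj₂ o)) x' × _⊑MIA_ R X r' x')
  ⊑-output (ℛ , isRef , rℛx) may with proj₂ (isRef _ _ rℛx) _ _ tt may
  ... | x' , weak , r'ℛx' = x' , weak , ℛ , isRef , r'ℛx'

module _ {I O : Set} (R X Y : MIA I O) where
  private
    module R = MIA R
    module X = MIA X
    module Y = MIA Y

  ⊑-output-must-joint : ∀ {r x y o X'} → _⊑MIA_ R X r x → _⊑MIA_ R Y r y →
    X.must x (inj₂ o) X' →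
    ∃[ r' ] ∃[ x' ] ∃[ y' ]
      (X' x' × Weak Y y (vis (inj₂ o)) y' × _⊑MIA_ R X r' x' × _⊑MIA_ R Y r' y')
  ⊑-output-must-joint r⊑x r⊑y m with ⊑-must R X r⊑x m
  ... | R' , m' , cover with R.must-nonempty m'
  ... | r' , r'∈ with cover r'∈ | ⊑-output R Y r⊑y (R.must⇒may m' r'∈)
  ... | x' , x'∈ , r'⊑x' | y' , weak , r'⊑y' = r' , x' , y' , x'∈ , weak , r'⊑x' , r'⊑y'

  -- Input determinism of R makes the two must-transitions of r one and the same.
  ⊑-input-must-joint : ∀ {r x y i X' Y'} → _⊑MIA_ R X r x → _⊑MIA_ R Y r y →
    X.must x (inj₁ i) X' → Y.must y (inj₁ i) Y' →
    ∃[ r' ] ∃[ x' ] ∃[ y' ] (X' x' × Y' y' × _⊑MIA_ R X r' x' × _⊑MIA_ R Y r' y')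
  ⊑-input-must-joint r⊑x r⊑y mx my with ⊑-must R X r⊑x mx | ⊑-must R Y r⊑y my
  ... | _ , m₁ , cover₁ | _ , m₂ , cover₂ with R.must-nonempty m₁
  ... | r' , r'∈ with cover₁ r'∈ | cover₂ (proj₁ (R.inp-det m₁ m₂) r'∈)
  ... | x' , x'∈ , r'⊑x' | y' , y'∈ , r'⊑y' = r' , x' , y' , x'∈ , y'∈ , r'⊑x' , r'⊑y'

module _ {I O : Set} (P Q : MIA I O) where
  open Conj P Q
  private
    module P = MIA P
    module Q = MIA Q

  witness-disjoint-F : ∀ {ℓ} (W : Pred St ℓ) → IsWitness W → ∀ s → W s → F s → ⊥
  witness-disjoint-F W wit _ w (F1 {p} {q} {o} hm nw) = nw (proj₁ (wit p q w) o hm)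
  witness-disjoint-F W wit _ w (F2 {p} {q} {o} nw hm) = nw (proj₁ (proj₂ (wit p q w)) o hm)
  witness-disjoint-F W wit _ w (F3 {p} {q} {a} {R'} m allF)
    with proj₂ (proj₂ (wit p q w)) a R' m
  ... | s , s∈ , ws = witness-disjoint-F W wit s ws (allF s s∈)

  commonRef-isWitness : IsWitness CommonRef
  commonRef-isWitness p q (R , r , r⊑p , r⊑q) =
      (λ _ (_ , m) → let _ , _ , q' , _ , weak , _ = ⊑-output-must-joint R P Q r⊑p r⊑q m
                     in q' , weak)
    , (λ _ (_ , m) → let _ , _ , p' , _ , weak , _ = ⊑-output-must-joint R Q P r⊑q r⊑p m
                     in p' , weak)
    , successor
    where
    successor : ∀ a R' → Must (pair p q) a R' → ∃[ s ] (R' s × CommonRef s)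
    successor _ _ (OMust1 m _) with ⊑-output-must-joint R P Q r⊑p r⊑q m
    ... | r' , p' , q' , p'∈ , weak , r'⊑p' , r'⊑q' =
      pair p' q' , (p'∈ , weak) , R , r' , r'⊑p' , r'⊑q'
    successor _ _ (OMust2 _ m) with ⊑-output-must-joint R Q P r⊑q r⊑p m
    ... | r' , q' , p' , q'∈ , weak , r'⊑q' , r'⊑p' =
      pair p' q' , (weak , q'∈) , R , r' , r'⊑p' , r'⊑q'
    successor _ _ (IMust1 m _) with P.must-nonempty m
    ... | p' , p'∈ = inj₂ (inj₁ p') , p'∈ , lift tt
    successor _ _ (IMust2 _ m) with Q.must-nonempty m
    ... | q' , q'∈ = inj₂ (inj₂ q') , q'∈ , lift tt
    successor _ _ (IMust3 mp mq) with ⊑-input-must-joint R P Q r⊑p r⊑q mp mq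
    ... | r' , p' , q' , p'∈ , q'∈ , r'⊑p' , r'⊑q' =
      pair p' q' , (p'∈ , q'∈) , R , r' , r'⊑p' , r'⊑q'

lemma4p6 : ∀ {ℓ : Level} {I O : Set} (P Q : MIA I O) →
    (∀ (W : Pred (Conj.St P Q) ℓ) → Conj.IsWitness P Q W →
       ∀ s → W s → Conj.F P Q s → ⊥)
    × Conj.IsWitness P Q (Conj.CommonRef P Q)
lemma4p6 P Q = witness-disjoint-F P Q , commonRef-isWitness P Q
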